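{- Let $G$ be an abelian group, $r,\ell\in\mathbb N$, and let $\mathcal A=(A_1,\dots,A_q)$ be a chromatic asymptotic $(r,\ell)$-approximate group in $G$. Let $B\subseteq G$ be a nonempty finite set with $|B|=m$. Then the family $S_{\mathbf h}:=\mathbf h\cdot\mathcal A+B$ ($\mathbf h\in\mathbb N_0^q$) is an asymptotic $\left(r,\ell\binom{(r+1)(m-1)}{m-1}\right)$-approximate family.
   Context: $\mathbb N=\{1,2,\dots\}$, $\mathbb N_0=\{0,1,2,\dots\}$. For subsets $X,Y$, $X+Y=\{x+y:x\in X,y\in Y\}$; for $h\in\mathbb N$, $hA$ is the $h$-fold sumset $A+\cdots+A$ and $0A=\{0\}$. For a tuple $\mathcal A$ of nonempty subsets of $G$ and $\mathbf h=(h_1,\dots,h_q)\in\mathbb N_0^q$, $\mathbf h\cdot\mathcal A=h_1A_1+\cdots+h_qA_q$, $r\mathbf h=(rh_1,\dots,rh_q)$, and $\mathbf h\preceq\mathbf h'$ means $h_i\le h_i'$ for all $i$. $\mathcal A$ is a chromatic asymptotic $(r,\ell)$-approximate group if there is $\mathbf h_0$ such that for every $\mathbf h\succeq\mathbf h_0$ there is $X_{\mathbf h}\subseteq G$ with $|X_{\mathbf h}|\le\ell$ and $(r\mathbf h)\cdot\mathcal A\subseteq X_{\mathbf h}+\mathbf h\cdot\mathcal A$. For nonempty $B\subseteq G$, the family $\mathbf h\cdot\mathcal A+B$ is an asymptotic $(r,L)$-approximate family if there is $\mathbf h_0$ such that for every $\mathbf h\succeq\mathbf h_0$ there is $Y_{\mathbf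 h}\subseteq G$ with $|Y_{\mathbf h}|\le L$ and $r(\mathbf h\cdot\mathcal A+B)\subseteq Y_{\mathbf h}+\mathbf h\cdot\mathcal A+B$. -}

module Defs where

open import Level using (Level; _⊔_; Lift)
open import Algebra.Bundles using (AbelianGroup)
open import Data.Nat using (ℕ; zero; suc; _≤_; _*_)
open import Data.Fin using (Fin; zero; suc)
open import Data.List using (List; length)
open import Data.List.Relation.Unary.Any using (Any)
open import Data.List.Relation.Unary.AllPairs using (AllPairs)
open import Data.Product using (Σ; ∃; _×_)
open import Relation.Nullary using (¬_)

module Sumsets {c ℓ : Level} (G : AbelianGroup c ℓ) where
  open AbelianGroup G

  Subset : Set (Level.suc (c ⊔ ℓ))
  Subset = Carrier → Set (c ⊔ ℓ)

  _⊆_ : Subset → Subset → Set (c ⊔ ℓ)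
  X ⊆ Y = ∀ x → X x → Y x

  _⊕_ : Subset → Subset → Subset
  (X ⊕ Y) z = Σ Carrier λ x → Σ Carrier λ y → X x × Y y × (z ≈ x ∙ y)

  zeroSet : Subset
  zeroSet z = Lift c (z ≈ ε)

  _·_ : ℕ → Subset → Subset
  zero · A = zeroSet
  suc h · A = A ⊕ (h · A)

  _··_ : ∀ {q} → (Fin q → ℕ) → (Fin q → Subset) → Subset
  _··_ {zero} h 𝒜 = zeroSet
  _··_ {suc q} h 𝒜 = (h zero · 𝒜 zero) ⊕ ((λ i → h (suc i)) ·· (λ i → 𝒜 (suc i)))

  fromList : List Carrier → Subset
  fromList xs z = Lift c (Any (z ≈_) xs)

  -- a list without repetitions (w.r.t. ≈); |fromList xs| = length xs
  Distinct : List Carrier → Set (c ⊔ ℓ)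
  Distinct = AllPairs (λ a b → ¬ (a ≈ b))

  _≼_ : ∀ {q} → (Fin q → ℕ) → (Fin q → ℕ) → Set
  h ≼ h' = ∀ i → h i ≤ h' i

  _⋆_ : ∀ {q} → ℕ → (Fin q → ℕ) → (Fin q → ℕ)
  (r ⋆ h) i = r * h i

  ChromaticAsymptoticApproxGroup : ∀ {q} → ℕ → ℕ → (Fin q → Subset) → Set (c ⊔ ℓ)
  ChromaticAsymptoticApproxGroup {q} r l 𝒜 =
    (∀ i → ∃ λ x → 𝒜 i x) ×
    Σ (Fin q → ℕ) λ h₀ → ∀ h → h₀ ≼ h →
      Σ (List Carrier) λ X → length X ≤ l ×
        ((r ⋆ h) ·· 𝒜) ⊆ (fromList X ⊕ (h ·· 𝒜))

  AsymptoticApproxFamily : ∀ {q} → ℕ → ℕ → ((Fin q → ℕ) → Subset) → Set (c ⊔ ℓ)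
  AsymptoticApproxFamily {q} r L S =
    Σ (Fin q → ℕ) λ h₀ → ∀ h → h₀ ≼ h →
      Σ (List Carrier) λ Y → length Y ≤ L ×
        (r · S h) ⊆ (fromList Y ⊕ S h)

-- r(h·𝒜 + B) ⊆ (rh)·𝒜 + rB ⊆ (X_h + h·𝒜) + ((r−1)B + B) = (X_h + (r−1)B) + S_h,
-- so Y_h = X_h + (r−1)B works. Listing (r−1)B by the sums of the (r−1)-element multisets
-- from B gives |(r−1)B| ≤ C(m−1+r−1, m−1) ≤ C((r+1)(m−1), m−1).
module Submission where

open import Defs
open import Level using (Level; lift; lower)
open import Algebra.Bundles using (AbelianGroup)
open import Data.Nat using (ℕ; zero; suc; _≤_; _≤′_; ≤′-refl; ≤′-step; _*_; _+_; _∸_; s≤s)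
open import Data.Nat.Properties
open import Data.Nat.Combinatorics using (_C_; nCk≡nC[n∸k]; nCn≡1; nCk+nC[k+1]≡[n+1]C[k+1])
open import Data.Fin using (Fin)
open import Data.List using (List; []; _∷_; length; map; _++_; cartesianProductWith)
open import Data.List.Properties using (length-++; length-map)
open import Data.List.Relation.Unary.Any using (here; there)
open import Data.List.Membership.Setoid.Properties
  using (∈-resp-≈; ∈-map⁺; ∈-map⁻; ∈-++⁺ˡ; ∈-++⁺ʳ; ∈-++⁻; ∈-cartesianProductWith⁺)
open import Data.Product using (Σ; _×_; _,_; map₁; map₂)
open import Data.Sum using ([_,_]′)
open import Function using (_∘_)
open import Relation.Binary.Definitions using (_Respects_)
open import Relation.Binary.PropositionalEquality as ≡ using (_≡_)

nCk≤[1+n]Ck : ∀ n k → n C k ≤ suc n C k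
nCk≤[1+n]Ck n zero    = ≤-refl
nCk≤[1+n]Ck n (suc k) =
  ≤-trans (m≤n+m (n C suc k) (n C k)) (≤-reflexive (nCk+nC[k+1]≡[n+1]C[k+1] n k))

C-monoˡ-≤ : ∀ {m n} k → m ≤ n → m C k ≤ n C k
C-monoˡ-≤ k = mono′ ∘ ≤⇒≤′
  where
  mono′ : ∀ {m n} → m ≤′ n → m C k ≤ n C k
  mono′ ≤′-refl        = ≤-refl
  mono′ (≤′-step m≤′n) = ≤-trans (mono′ m≤′n) (nCk≤[1+n]Ck _ k)

[n+k]Ck≤[[k+2]*n]Cn : ∀ k n → (n + k) C k ≤ ((suc k + 1) * n) C n
[n+k]Ck≤[[k+2]*n]Cn k n = ≤-trans (≤-reflexive symmetry) (bound n)
  where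
  symmetry : (n + k) C k ≡ (n + k) C n
  symmetry = ≡.trans (nCk≡nC[n∸k] (m≤n+m k n)) (≡.cong ((n + k) C_) (m+n∸n≡m n k))

  bound : ∀ n → (n + k) C n ≤ ((suc k + 1) * n) C n
  bound zero    = ≤-refl
  bound (suc j) = C-monoˡ-≤ (suc j) (begin
    suc j + k                 ≡⟨ +-comm (suc j) k ⟩
    k + suc j                 ≤⟨ +-monoˡ-≤ (suc j) (m≤m+n k 1) ⟩
    (k + 1) + suc j           ≤⟨ +-monoˡ-≤ (suc j) (m≤m*n (k + 1) (suc j)) ⟩
    (k + 1) * suc j + suc j   ≡⟨ +-comm ((k + 1) * suc j) (suc j) ⟩
    (suc k + 1) * suc j       ∎)
    where open ≤-Reasoning

length-cartesianProductWith : ∀ {a b c} {A : Set a} {B : Set b} {C : Set c}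
  (f : A → B → C) xs ys → length (cartesianProductWith f xs ys) ≡ length xs * length ys
length-cartesianProductWith f []       ys = ≡.refl
length-cartesianProductWith f (x ∷ xs) ys = begin
  length (map (f x) ys ++ cartesianProductWith f xs ys)
    ≡⟨ length-++ (map (f x) ys) ⟩
  length (map (f x) ys) + length (cartesianProductWith f xs ys)
    ≡⟨ ≡.cong₂ _+_ (length-map (f x) ys) (length-cartesianProductWith f xs ys) ⟩
  length ys + length xs * length ys ∎
  where open ≡.≡-Reasoning

module _ {c ℓ : Level} (G : AbelianGroup c ℓ) where
  open AbelianGroup G
  open Sumsets G
  open import Algebra.Properties.CommutativeSemigroup commutativeSemigroup
    using (interchange; x∙yz≈y∙xz)
  open import Data.List.Membership.Setoid setoid using (_∈_)

  private variable
    A B W X Y Z : Subset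

  ⊆-refl : X ⊆ X
  ⊆-refl _ x∈X = x∈X

  ⊆-trans : X ⊆ Y → Y ⊆ Z → X ⊆ Z
  ⊆-trans X⊆Y Y⊆Z x = Y⊆Z x ∘ X⊆Y x

  ⊕-resp-≈ : (X ⊕ Y) Respects _≈_
  ⊕-resp-≈ z≈z′ (x , y , x∈X , y∈Y , z≈xy) = x , y , x∈X , y∈Y , trans (sym z≈z′) z≈xy

  ·-resp-≈ : ∀ n → (n · A) Respects _≈_
  ·-resp-≈ zero    z≈z′ (lift z≈ε) = lift (trans (sym z≈z′) z≈ε)
  ·-resp-≈ (suc n) z≈z′ z∈        = ⊕-resp-≈ z≈z′ z∈

  ⊕-mono : X ⊆ Y → Z ⊆ W → (X ⊕ Z) ⊆ (Y ⊕ W)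
  ⊕-mono X⊆Y Z⊆W _ (x , z , x∈X , z∈Z , e) = x , z , X⊆Y x x∈X , Z⊆W z z∈Z , e

  ⊕-comm : (X ⊕ Y) ⊆ (Y ⊕ X)
  ⊕-comm _ (x , y , x∈X , y∈Y , e) = y , x , y∈Y , x∈X , trans e (comm x y)

  ⊕-assoc : ((X ⊕ Y) ⊕ Z) ⊆ (X ⊕ (Y ⊕ Z))
  ⊕-assoc _ (u , z , (x , y , x∈X , y∈Y , u≈xy) , z∈Z , e) =
    x , y ∙ z , x∈X , (y , z , y∈Y , z∈Z , refl) ,
    trans e (trans (∙-congʳ u≈xy) (assoc x y z))

  ⊕-interchange : ((W ⊕ X) ⊕ (Y ⊕ Z)) ⊆ ((W ⊕ Y) ⊕ (X ⊕ Z))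
  ⊕-interchange _ (u , v , (w , x , w∈W , x∈X , u≈wx) , (y , z , y∈Y , z∈Z , v≈yz) , e) =
    w ∙ y , x ∙ z , (w , y , w∈W , y∈Y , refl) , (x , z , x∈X , z∈Z , refl) ,
    trans e (trans (∙-cong u≈wx v≈yz) (interchange w x y z))

  0⊕X⊆X : X Respects _≈_ → (zeroSet ⊕ X) ⊆ X
  0⊕X⊆X resp _ (o , x , lift o≈ε , x∈X , e) =
    resp (sym (trans e (trans (∙-congʳ o≈ε) (identityˡ x)))) x∈X

  m·A⊕n·A⊆[m+n]·A : ∀ m n → ((m · A) ⊕ (n · A)) ⊆ ((m + n) · A)
  m·A⊕n·A⊆[m+n]·A zero    n = 0⊕X⊆X (·-resp-≈ n)
  m·A⊕n·A⊆[m+n]·A (suc m) n = ⊆-trans ⊕-assoc (⊕-mono ⊆-refl (m·A⊕n·A⊆[m+n]·A m n))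

  m·n·A⊆[m*n]·A : ∀ m n → (m · (n · A)) ⊆ ((m * n) · A)
  m·n·A⊆[m*n]·A zero    n = ⊆-refl
  m·n·A⊆[m*n]·A (suc m) n =
    ⊆-trans (⊕-mono ⊆-refl (m·n·A⊆[m*n]·A m n)) (m·A⊕n·A⊆[m+n]·A n (m * n))

  n·[X⊕Y]⊆n·X⊕n·Y : ∀ n → (n · (X ⊕ Y)) ⊆ ((n · X) ⊕ (n · Y))
  n·[X⊕Y]⊆n·X⊕n·Y zero    _ (lift z≈ε) =
    ε , ε , lift refl , lift refl , trans z≈ε (sym (identityˡ ε))
  n·[X⊕Y]⊆n·X⊕n·Y (suc n) = ⊆-trans (⊕-mono ⊆-refl (n·[X⊕Y]⊆n·X⊕n·Y n)) ⊕-interchange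

  n·0⊆0 : ∀ n → (n · zeroSet) ⊆ zeroSet
  n·0⊆0 zero    = ⊆-refl
  n·0⊆0 (suc n) = ⊆-trans (0⊕X⊆X (·-resp-≈ n)) (n·0⊆0 n)

  n·[h··𝒜]⊆[n⋆h]··𝒜 : ∀ {q} n (h : Fin q → ℕ) (𝒜 : Fin q → Subset) →
                      (n · (h ·· 𝒜)) ⊆ ((n ⋆ h) ·· 𝒜)
  n·[h··𝒜]⊆[n⋆h]··𝒜 {zero}  n h 𝒜 = n·0⊆0 n
  n·[h··𝒜]⊆[n⋆h]··𝒜 {suc q} n h 𝒜 =
    ⊆-trans (n·[X⊕Y]⊆n·X⊕n·Y n)
            (⊕-mono (m·n·A⊆[m*n]·A n (h Fin.zero))
                    (n·[h··𝒜]⊆[n⋆h]··𝒜 n (h ∘ Fin.suc) (𝒜 ∘ Fin.suc)))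

  fromList⊕fromList⊆fromList-sums : ∀ xs ys →
    (fromList xs ⊕ fromList ys) ⊆ fromList (cartesianProductWith _∙_ xs ys)
  fromList⊕fromList⊆fromList-sums xs ys _ (x , y , lift x∈xs , lift y∈ys , z≈xy) =
    lift (∈-resp-≈ setoid (sym z≈xy)
           (∈-cartesianProductWith⁺ setoid setoid setoid ∙-cong x∈xs y∈ys))

  ChromaticAsymptoticApproxGroup⇒AsymptoticApproxFamily :
    ∀ {q r l} {𝒜 : Fin q → Subset} (zs : List Carrier) →
    ChromaticAsymptoticApproxGroup r l 𝒜 → (r · B) ⊆ (fromList zs ⊕ B) →
    AsymptoticApproxFamily r (l * length zs) (λ h → (h ·· 𝒜) ⊕ B)
  ChromaticAsymptoticApproxGroup⇒AsymptoticApproxFamily {B = B} {r = r} {l = l} {𝒜 = 𝒜}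
    zs (_ , h₀ , cover) rB⊆ = h₀ , λ h h₀≼h → translates h (cover h h₀≼h)
    where
    translates : ∀ h →
      Σ (List Carrier) (λ X → length X ≤ l × ((r ⋆ h) ·· 𝒜) ⊆ (fromList X ⊕ (h ·· 𝒜))) →
      Σ (List Carrier) (λ Y → length Y ≤ l * length zs ×
                              (r · ((h ·· 𝒜) ⊕ B)) ⊆ (fromList Y ⊕ ((h ·· 𝒜) ⊕ B)))
    translates h (xs , |xs|≤l , r⋆h⊆) =
      cartesianProductWith _∙_ xs zs ,
      ≤-trans (≤-reflexive (length-cartesianProductWith _∙_ xs zs)) (*-monoˡ-≤ (length zs) |xs|≤l) ,
      ⊆-trans (n·[X⊕Y]⊆n·X⊕n·Y r)
        (⊆-trans (⊕-mono (⊆-trans (n·[h··𝒜]⊆[n⋆h]··𝒜 r h 𝒜) r⋆h⊆) rB⊆)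
        (⊆-trans ⊕-interchange (⊕-mono (fromList⊕fromList⊆fromList-sums xs zs) ⊆-refl)))

  AsymptoticApproxFamily-mono : ∀ {q r L L′} {S : (Fin q → ℕ) → Subset} → L ≤ L′ →
    AsymptoticApproxFamily r L S → AsymptoticApproxFamily r L′ S
  AsymptoticApproxFamily-mono L≤L′ (h₀ , family) =
    h₀ , λ h h₀≼h → map₂ (map₁ (λ |Y|≤L → ≤-trans |Y|≤L L≤L′)) (family h h₀≼h)

  -- The sum of each k-element multiset drawn from the list, listed once: such a multiset
  -- either contains the head b (then remove one copy of b) or avoids b.
  multisetSums : ℕ → List Carrier → List Carrier
  multisetSums zero    _        = ε ∷ []
  multisetSums (suc k) []       = []
  multisetSums (suc k) (b ∷ bs) = map (b ∙_) (multisetSums k (b ∷ bs)) ++ multisetSums (suc k) bs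

  ∙-∈-multisetSums : ∀ k bs {x y} → x ∈ bs → y ∈ multisetSums k bs → x ∙ y ∈ multisetSums (suc k) bs
  ∙-∈-multisetSums k (b ∷ bs) (here x≈b) y∈ =
    ∈-++⁺ˡ setoid (∈-resp-≈ setoid (∙-congʳ (sym x≈b)) (∈-map⁺ setoid setoid ∙-congˡ y∈))
  ∙-∈-multisetSums zero (b ∷ bs) (there x∈bs) y∈ =
    ∈-++⁺ʳ setoid _ (∙-∈-multisetSums zero bs x∈bs y∈)
  ∙-∈-multisetSums (suc k) (b ∷ bs) {x} {y} (there x∈bs) y∈ =
    [ viaHead , (λ y∈rest → ∈-++⁺ʳ setoid _ (∙-∈-multisetSums (suc k) bs x∈bs y∈rest)) ]′
      (∈-++⁻ setoid (map (b ∙_) (multisetSums k (b ∷ bs))) y∈)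
    where
    viaHead : y ∈ map (b ∙_) (multisetSums k (b ∷ bs)) →
              x ∙ y ∈ multisetSums (suc (suc k)) (b ∷ bs)
    viaHead y∈b∙ =
      let w , w∈ , y≈bw = ∈-map⁻ setoid setoid y∈b∙
          xw∈ = ∙-∈-multisetSums k (b ∷ bs) (there x∈bs) w∈
      in ∈-++⁺ˡ setoid (∈-resp-≈ setoid (sym (trans (∙-congˡ y≈bw) (x∙yz≈y∙xz x b w)))
                                        (∈-map⁺ setoid setoid ∙-congˡ xw∈))

  k·fromList⊆fromList-multisetSums : ∀ k bs → (k · fromList bs) ⊆ fromList (multisetSums k bs)
  k·fromList⊆fromList-multisetSums zero    bs _ (lift z≈ε) = lift (here z≈ε)
  k·fromList⊆fromList-multisetSums (suc k) bs _ (x , y , lift x∈bs , y∈ , z≈xy) =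
    lift (∈-resp-≈ setoid (sym z≈xy)
           (∙-∈-multisetSums k bs x∈bs (lower (k·fromList⊆fromList-multisetSums k bs y y∈))))

  [1+k]·fromList⊆multisetSums⊕fromList : ∀ k bs →
    (suc k · fromList bs) ⊆ (fromList (multisetSums k bs) ⊕ fromList bs)
  [1+k]·fromList⊆multisetSums⊕fromList k bs =
    ⊆-trans ⊕-comm (⊕-mono (k·fromList⊆fromList-multisetSums k bs) ⊆-refl)

  length-multisetSums-suc : ∀ k b bs → length (multisetSums (suc k) (b ∷ bs)) ≡
    length (multisetSums k (b ∷ bs)) + length (multisetSums (suc k) bs)
  length-multisetSums-suc k b bs = begin
    length (map (b ∙_) (multisetSums k (b ∷ bs)) ++ multisetSums (suc k) bs)
      ≡⟨ length-++ (map (b ∙_) (multisetSums k (b ∷ bs))) ⟩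
    length (map (b ∙_) (multisetSums k (b ∷ bs))) + length (multisetSums (suc k) bs)
      ≡⟨ ≡.cong (_+ _) (length-map (b ∙_) (multisetSums k (b ∷ bs))) ⟩
    length (multisetSums k (b ∷ bs)) + length (multisetSums (suc k) bs) ∎
    where open ≡.≡-Reasoning

  length-multisetSums : ∀ k b bs → length (multisetSums k (b ∷ bs)) ≡ (length bs + k) C k
  length-multisetSums zero    b bs       = ≡.refl
  length-multisetSums (suc k) b []       = begin
    length (multisetSums (suc k) (b ∷ [])) ≡⟨ length-multisetSums-suc k b [] ⟩
    length (multisetSums k (b ∷ [])) + 0 ≡⟨ +-identityʳ _ ⟩
    length (multisetSums k (b ∷ []))     ≡⟨ length-multisetSums k b [] ⟩
    k C k                                ≡⟨ nCn≡1 k ⟩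
    1                                    ≡⟨ nCn≡1 (suc k) ⟨
    suc k C suc k                        ∎
    where open ≡.≡-Reasoning
  length-multisetSums (suc k) b (c ∷ cs) = begin
    length (multisetSums (suc k) (b ∷ c ∷ cs))
      ≡⟨ length-multisetSums-suc k b (c ∷ cs) ⟩
    length (multisetSums k (b ∷ c ∷ cs)) + length (multisetSums (suc k) (c ∷ cs))
      ≡⟨ ≡.cong₂ _+_ (length-multisetSums k b (c ∷ cs)) (length-multisetSums (suc k) c cs) ⟩
    (suc n + k) C k + (n + suc k) C suc k
      ≡⟨ ≡.cong (λ m → (suc n + k) C k + m C suc k) (+-suc n k) ⟩
    (suc n + k) C k + (suc n + k) C suc k
      ≡⟨ nCk+nC[k+1]≡[n+1]C[k+1] (suc n + k) k ⟩
    suc (suc n + k) C suc k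
      ≡⟨ ≡.cong (_C suc k) (+-suc (suc n) k) ⟨
    (suc n + suc k) C suc k ∎
    where
    n = length cs
    open ≡.≡-Reasoning

theorem1p16 : {c ℓ : Level} (G : AbelianGroup c ℓ) →
    let open AbelianGroup G using (Carrier) in
    let open Sumsets G in
    (r l q : ℕ) → 1 ≤ r → 1 ≤ l →
    (𝒜 : Fin q → Subset) → ChromaticAsymptoticApproxGroup r l 𝒜 →
    (bs : List Carrier) → Distinct bs → 1 ≤ length bs →
    AsymptoticApproxFamily r (l * (((r + 1) * (length bs ∸ 1)) C (length bs ∸ 1)))
      (λ h → (h ·· 𝒜) ⊕ fromList bs)
theorem1p16 G (suc k) l q (s≤s _) _ 𝒜 𝒜-approx (b ∷ bs) _ (s≤s _) =
  AsymptoticApproxFamily-mono G {r = suc k} (*-monoʳ-≤ l |[r-1]B|≤C)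
    (ChromaticAsymptoticApproxGroup⇒AsymptoticApproxFamily G {r = suc k}
      (multisetSums G k (b ∷ bs)) 𝒜-approx ([1+k]·fromList⊆multisetSums⊕fromList G k (b ∷ bs)))
  where
  |[r-1]B|≤C : length (multisetSums G k (b ∷ bs)) ≤ ((suc k + 1) * length bs) C length bs
  |[r-1]B|≤C =
    ≤-trans (≤-reflexive (length-multisetSums G k b bs)) ([n+k]Ck≤[[k+2]*n]Cn k (length bs))
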